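{- Let $\mathcal{A}$ be a finite union-closed, separating collection of sets with universe $U(\mathcal{A})=\{1,\dots,m\}$, where the elements are numbered so that $|1|_{\mathcal{A}}\le |2|_{\mathcal{A}}\le\dots\le|m|_{\mathcal{A}}$. For each $i\in\{1,\dots,m-1\}$ let $A_i:=\bigcup_{\{A\in\mathcal{A}\,:\, i\notin A\}}A$, let $A_0:=U(\mathcal{A})$, and let $\mathcal{S}=\{A_0,A_1,\dots,A_{m-1}\}$. Then for every $i\in\{1,\dots,m-1\}$: if $|i|_{\mathcal{S}}<m-1$, there exists an element $k\in\{1,\dots,m-1\}$ with $|k|_{\mathcal{S}}=m-1$ that dominates $i$ in $\mathcal{A}$.
   Context: A collection $\mathcal{A}$ is union-closed if $S,T\in\mathcal{A}$ implies $S\cup T\in\mathcal{A}$. The universe $U(\mathcal{A})=\bigcup_{A\in\mathcal{A}}A$. $\mathcal{A}$ is separating if for any two distinct elements of $U(\mathcal{A})$ there is a set in $\mathcal{A}$ containing one of them but not the other. For an element $a$ and a collection $\mathcal{B}$, $|a|_{\mathcal{B}}$ denotes the number of sets in $\mathcal{B}$ containing $a$. An element $b$ dominates an element $c$ in $\mathcal{A}$ if every set of $\mathcal{A}$ containing $c$ also contains $b$. (Under the hypotheses, each $A_i$ belongs to $\mathcal{A}$, and $A_i$ contains all $j>i$ but not $i$.) -}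

module Defs where

open import Data.Nat using (ℕ; suc; _<_; _<?_)
open import Data.Fin using (Fin; toℕ)
open import Data.Fin.Subset using (Subset; _∈_; _∉_; _∪_; ⋃)
open import Data.Fin.Subset.Properties using (_∈?_)
open import Data.List using (List; _∷_; filter; length; map; allFin)
import Data.List.Membership.Propositional as LM
open import Data.Product using (Σ; _×_)
open import Data.Sum using (_⊎_)
open import Relation.Nullary using (¬_; ¬?)
open import Relation.Binary.PropositionalEquality using (_≡_; _≢_)

-- Elements of the universe {1,…,m} are represented by Fin m:
-- the Fin index j stands for the paper's element j+1.
-- A finite collection of sets is a duplicate-free list of subsets of Fin m.

count : ∀ {m} → Fin m → List (Subset m) → ℕ
count a B = length (filter (a ∈?_) B)

UnionClosed : ∀ {m} → List (Subset m) → Set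
UnionClosed 𝒜 = ∀ S T → S LM.∈ 𝒜 → T LM.∈ 𝒜 → (S ∪ T) LM.∈ 𝒜

Universe : ∀ {m} → List (Subset m) → Subset m
Universe 𝒜 = ⋃ 𝒜

Separating : ∀ {m} → List (Subset m) → Set
Separating {m} 𝒜 = (x y : Fin m) → x ≢ y →
  Σ (Subset m) λ A → A LM.∈ 𝒜 × ((x ∈ A × y ∉ A) ⊎ (y ∈ A × x ∉ A))

Dominates : ∀ {m} → List (Subset m) → Fin m → Fin m → Set
Dominates 𝒜 b c = ∀ A → A LM.∈ 𝒜 → c ∈ A → b ∈ A

Aset : ∀ {m} → List (Subset m) → Fin m → Subset m
Aset 𝒜 i = ⋃ (filter (λ A → ¬? (i ∈? A)) 𝒜)

-- indices j with j+1 ∈ {1,…,m-1}, i.e. suc (toℕ j) < m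
lowIdx : (m : ℕ) → List (Fin m)
lowIdx m = filter (λ j → suc (toℕ j) <? m) (allFin m)

Scoll : ∀ {m} → List (Subset m) → List (Subset m)
Scoll {m} 𝒜 = Universe 𝒜 ∷ map (Aset 𝒜) (lowIdx m)

-- Write A_l for the union of the sets of 𝒜 avoiding l; then j ∉ A_l exactly when l dominates
-- j. Since j ∉ A_j and j ∈ A_0 = U(𝒜), an element j ≤ m-1 has |j|_𝒮 = m-1 exactly when no
-- other l ≤ m-1 dominates it. Separation makes domination by a smaller element strict, which
-- the ordering by degree forbids, so any other dominator of j has a larger index. Starting
-- from i and repeatedly passing to such a dominator therefore stops, at an element k that
-- dominates i (domination is transitive) and has |k|_𝒮 = m-1.
module Submission where

open import Defs
open import Data.Nat using (ℕ; zero; suc; _<_; _≤_; _∸_; _<?_; z≤n; s≤s)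
open import Data.Nat.Properties using (≤∧≢⇒<; <-cmp; <-irrefl; <⇒≤; m≤n⇒m≤1+n; <-≤-trans; suc-injective)
open import Data.Fin using (Fin; toℕ; fromℕ; _≟_; _>_)
open import Data.Fin.Properties using (toℕ-injective; toℕ-fromℕ; ≤fromℕ)
open import Data.Fin.Induction using (>-wellFounded)
open import Data.Fin.Subset using (Subset; ⊤; _∈_; _∉_; ⋃)
open import Data.Fin.Subset.Properties using (_∈?_; x∈p∪q⁻; x∈p∪q⁺; ∉⊥; ∈⊤)
open import Data.List using (List; []; _∷_; filter; length; map; allFin)
import Data.List.Membership.Propositional as LM
open import Data.List.Membership.Propositional.Properties using (∈-filter⁺; ∈-filter⁻; ∈-allFin)
open import Data.List.Relation.Unary.Any using (Any; here; there; any?)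
import Data.List.Relation.Unary.All as All
open import Data.List.Relation.Unary.Unique.Propositional using (Unique)
open import Data.List.Relation.Unary.Unique.Propositional.Properties using (allFin⁺; filter⁺)
open import Data.List.Relation.Unary.AllPairs using (_∷_)
open import Data.List.Properties using (filter-accept; filter-reject; filter-all; length-tabulate)
open import Data.Product using (Σ; _×_; _,_; proj₂)
open import Data.Sum using (inj₁; inj₂)
open import Data.Empty using (⊥-elim)
open import Induction.WellFounded using (Acc; acc)
open import Relation.Binary.Definitions using (tri<; tri≈; tri>)
open import Relation.Nullary using (¬_; ¬?; yes; no)
open import Relation.Nullary.Decidable using (_×-dec_)
open import Relation.Unary using (Pred; Decidable)
open import Relation.Binary.PropositionalEquality using (_≡_; _≢_; refl; sym; trans; cong; subst; ≢-sym; module ≡-Reasoning)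

∈-⋃⁺ : ∀ {m} {x : Fin m} {A} (As : List (Subset m)) → A LM.∈ As → x ∈ A → x ∈ ⋃ As
∈-⋃⁺ (B ∷ As) (here refl) x∈A = x∈p∪q⁺ (inj₁ x∈A)
∈-⋃⁺ (B ∷ As) (there A∈As) x∈A = x∈p∪q⁺ (inj₂ (∈-⋃⁺ As A∈As x∈A))

∈-⋃⁻ : ∀ {m} {x : Fin m} (As : List (Subset m)) → x ∈ ⋃ As → Σ (Subset m) λ A → A LM.∈ As × x ∈ A
∈-⋃⁻ [] x∈⊥ = ⊥-elim (∉⊥ x∈⊥)
∈-⋃⁻ (A ∷ As) x∈ with x∈p∪q⁻ A (⋃ As) x∈
... | inj₁ x∈A = A , here refl , x∈A
... | inj₂ x∈⋃As with ∈-⋃⁻ As x∈⋃As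
...   | B , B∈As , x∈B = B , there B∈As , x∈B

module _ {a p} {X : Set a} {P Q : Pred X p} (P? : Decidable P) (Q? : Decidable Q) where

  length-filter-mono-≤ : ∀ xs → (∀ {x} → x LM.∈ xs → P x → Q x) →
                         length (filter P? xs) ≤ length (filter Q? xs)
  length-filter-mono-≤ [] P⇒Q = z≤n
  length-filter-mono-≤ (x ∷ xs) P⇒Q with P? x | Q? x | length-filter-mono-≤ xs (λ y∈ → P⇒Q (there y∈))
  ... | yes px | yes _  | ih = s≤s ih
  ... | yes px | no ¬qx | _  = ⊥-elim (¬qx (P⇒Q (here refl) px))
  ... | no _   | yes _  | ih = m≤n⇒m≤1+n ih
  ... | no _   | no _   | ih = ih

  length-filter-mono-< : ∀ xs → (∀ {x} → x LM.∈ xs → P x → Q x) → Any (λ x → Q x × ¬ P x) xs →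
                         length (filter P? xs) < length (filter Q? xs)
  length-filter-mono-< (x ∷ xs) P⇒Q (here (qx , ¬px)) with P? x | Q? x
  ... | yes px | _      = ⊥-elim (¬px px)
  ... | no _   | yes _  = s≤s (length-filter-mono-≤ xs (λ y∈ → P⇒Q (there y∈)))
  ... | no _   | no ¬qx = ⊥-elim (¬qx qx)
  length-filter-mono-< (x ∷ xs) P⇒Q (there witness)
    with P? x | Q? x | length-filter-mono-< xs (λ y∈ → P⇒Q (there y∈)) witness
  ... | yes px | yes _  | ih = s≤s ih
  ... | yes px | no ¬qx | _  = ⊥-elim (¬qx (P⇒Q (here refl) px))
  ... | no _   | yes _  | ih = m≤n⇒m≤1+n ih
  ... | no _   | no _   | ih = ih

length-filter-map : ∀ {a b p} {X : Set a} {Y : Set b} {P : Pred Y p} (P? : Decidable P) (f : X → Y) xs →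
                    length (filter P? (map f xs)) ≡ length (filter (λ x → P? (f x)) xs)
length-filter-map P? f [] = refl
length-filter-map P? f (x ∷ xs) with P? (f x)
... | yes _ = cong suc (length-filter-map P? f xs)
... | no _  = length-filter-map P? f xs

length-filter-rejecting-one : ∀ {a p} {X : Set a} {P : Pred X p} (P? : Decidable P) {k : X} {xs} →
  Unique xs → k LM.∈ xs → ¬ P k → (∀ {x} → x LM.∈ xs → x ≢ k → P x) →
  suc (length (filter P? xs)) ≡ length xs
length-filter-rejecting-one {P = P} P? {xs = x ∷ xs} (x∉xs ∷ unique) k∈ ¬pk p-rest with k∈
... | here refl = begin
  suc (length (filter P? (x ∷ xs))) ≡⟨ cong (λ ys → suc (length ys)) (filter-reject P? ¬pk) ⟩
  suc (length (filter P? xs))       ≡⟨ cong (λ ys → suc (length ys)) (filter-all P? all-p) ⟩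
  suc (length xs)                   ∎
  where
  open ≡-Reasoning
  all-p : All.All P xs
  all-p = All.tabulate (λ y∈ → p-rest (there y∈) (≢-sym (All.lookup x∉xs y∈)))
... | there k∈xs = begin
  suc (length (filter P? (x ∷ xs))) ≡⟨ cong (λ ys → suc (length ys)) (filter-accept P? (p-rest (here refl) x≢k)) ⟩
  suc (suc (length (filter P? xs))) ≡⟨ cong suc (length-filter-rejecting-one P? unique k∈xs ¬pk (λ y∈ → p-rest (there y∈))) ⟩
  suc (length xs)                   ∎
  where
  open ≡-Reasoning
  x≢k : x ≢ _
  x≢k refl = All.lookup x∉xs k∈xs refl

lowIdx⁺ : ∀ {m} {j : Fin m} → suc (toℕ j) < m → j LM.∈ lowIdx m
lowIdx⁺ {m} = ∈-filter⁺ (λ j → suc (toℕ j) <? m) (∈-allFin _)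

lowIdx⁻ : ∀ {m} {j : Fin m} → j LM.∈ lowIdx m → suc (toℕ j) < m
lowIdx⁻ {m} j∈ = proj₂ (∈-filter⁻ (λ j → suc (toℕ j) <? m) {xs = allFin m} j∈)

lowIdx-unique : ∀ m → Unique (lowIdx m)
lowIdx-unique m = filter⁺ (λ j → suc (toℕ j) <? m) (allFin⁺ m)

-- Every index but the last one, fromℕ n, is low.
length-lowIdx : ∀ m → length (lowIdx m) ≡ m ∸ 1
length-lowIdx zero = refl
length-lowIdx (suc n) = suc-injective (begin
  suc (length (lowIdx (suc n))) ≡⟨ length-filter-rejecting-one (λ j → suc (toℕ j) <? suc n)
                                     (allFin⁺ (suc n)) (∈-allFin (fromℕ n)) last-not-low others-low ⟩
  length (allFin (suc n))       ≡⟨ length-tabulate {n = suc n} (λ j → j) ⟩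
  suc n                         ∎)
  where
  open ≡-Reasoning
  last-not-low : ¬ suc (toℕ (fromℕ n)) < suc n
  last-not-low rewrite toℕ-fromℕ n = <-irrefl refl
  others-low : ∀ {j} → j LM.∈ allFin (suc n) → j ≢ fromℕ n → suc (toℕ j) < suc n
  others-low {j} _ j≢last = s≤s (≤∧≢⇒< (subst (toℕ j ≤_) (toℕ-fromℕ n) (≤fromℕ j))
                                    (λ eq → j≢last (toℕ-injective (trans eq (sym (toℕ-fromℕ n))))))

module _ {m} (𝒜 : List (Subset m)) where

  private
    avoiding : Fin m → List (Subset m)
    avoiding l = filter (λ A → ¬? (l ∈? A)) 𝒜

  Dominates-refl : ∀ {j} → Dominates 𝒜 j j
  Dominates-refl _ _ j∈A = j∈A

  Dominates-trans : ∀ {a b c} → Dominates 𝒜 a b → Dominates 𝒜 b c → Dominates 𝒜 a c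
  Dominates-trans a↝b b↝c A A∈𝒜 c∈A = a↝b A A∈𝒜 (b↝c A A∈𝒜 c∈A)

  Dominates⇒∉Aset : ∀ {l j} → Dominates 𝒜 l j → j ∉ Aset 𝒜 l
  Dominates⇒∉Aset {l} l↝j j∈Al with ∈-⋃⁻ (avoiding l) j∈Al
  ... | A , A∈ , j∈A with ∈-filter⁻ (λ A → ¬? (l ∈? A)) {xs = 𝒜} A∈
  ...   | A∈𝒜 , l∉A = l∉A (l↝j A A∈𝒜 j∈A)

  ∉Aset⇒Dominates : ∀ {l j} → j ∉ Aset 𝒜 l → Dominates 𝒜 l j
  ∉Aset⇒Dominates {l} j∉Al A A∈𝒜 j∈A with l ∈? A
  ... | yes l∈A = l∈A
  ... | no l∉A  = ⊥-elim (j∉Al (∈-⋃⁺ (avoiding l) (∈-filter⁺ (λ A → ¬? (l ∈? A)) A∈𝒜 l∉A) j∈A))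

  ¬Dominates⇒∈Aset : ∀ {l j} → ¬ Dominates 𝒜 l j → j ∈ Aset 𝒜 l
  ¬Dominates⇒∈Aset {l} {j} ¬l↝j with j ∈? Aset 𝒜 l
  ... | yes j∈Al = j∈Al
  ... | no j∉Al  = ⊥-elim (¬l↝j (∉Aset⇒Dominates j∉Al))

  -- j is counted by A_0 = U(𝒜) and by every A_l except A_j.
  count-Scoll-undominated : Universe 𝒜 ≡ ⊤ → ∀ {j} → suc (toℕ j) < m →
    (∀ {l} → l LM.∈ lowIdx m → l ≢ j → ¬ Dominates 𝒜 l j) → count j (Scoll 𝒜) ≡ m ∸ 1
  count-Scoll-undominated U≡⊤ {j} j-low undominated = begin
    count j (Scoll 𝒜)
      ≡⟨ cong length (filter-accept (j ∈?_) {xs = map (Aset 𝒜) (lowIdx m)} (subst (j ∈_) (sym U≡⊤) ∈⊤)) ⟩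
    suc (length (filter (j ∈?_) (map (Aset 𝒜) (lowIdx m))))
      ≡⟨ cong suc (length-filter-map (j ∈?_) (Aset 𝒜) (lowIdx m)) ⟩
    suc (length (filter (λ l → j ∈? Aset 𝒜 l) (lowIdx m)))
      ≡⟨ length-filter-rejecting-one (λ l → j ∈? Aset 𝒜 l) (lowIdx-unique m) (lowIdx⁺ j-low)
           (Dominates⇒∉Aset Dominates-refl) (λ l∈ l≢j → ¬Dominates⇒∈Aset (undominated l∈ l≢j)) ⟩
    length (lowIdx m)
      ≡⟨ length-lowIdx m ⟩
    m ∸ 1 ∎
    where open ≡-Reasoning

module _ {m} {𝒜 : List (Subset m)} (separating : Separating 𝒜)
         (ordered : (a b : Fin m) → toℕ a ≤ toℕ b → count a 𝒜 ≤ count b 𝒜) where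

  -- A smaller dominator would, by separation, lie in strictly more sets than k.
  dominator-> : ∀ {l k} → l ≢ k → Dominates 𝒜 l k → l > k
  dominator-> {l} {k} l≢k l↝k with <-cmp (toℕ k) (toℕ l)
  ... | tri< k<l _ _ = k<l
  ... | tri≈ _ k≡l _ = ⊥-elim (l≢k (toℕ-injective (sym k≡l)))
  ... | tri> _ _ l<k with separating k l (≢-sym l≢k)
  ...   | A , A∈𝒜 , inj₁ (k∈A , l∉A) = ⊥-elim (l∉A (l↝k A A∈𝒜 k∈A))
  ...   | A , A∈𝒜 , inj₂ (l∈A , k∉A) = ⊥-elim (<-irrefl refl (<-≤-trans
            (length-filter-mono-< (k ∈?_) (l ∈?_) 𝒜 (l↝k _) (LM.lose A∈𝒜 (l∈A , k∉A)))
            (ordered l k (<⇒≤ l<k))))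

  climb : Universe 𝒜 ≡ ⊤ → ∀ {i} j → Acc _>_ j → suc (toℕ j) < m → Dominates 𝒜 j i →
    Σ (Fin m) λ k → suc (toℕ k) < m × count k (Scoll 𝒜) ≡ m ∸ 1 × Dominates 𝒜 k i
  climb U≡⊤ j (acc larger) j-low j↝i with any? (λ l → ¬? (l ≟ j) ×-dec ¬? (j ∈? Aset 𝒜 l)) (lowIdx m)
  ... | yes found with LM.find found
  ...   | l , l∈ , l≢j , j∉Al =
          climb U≡⊤ l (larger (dominator-> l≢j l↝j)) (lowIdx⁻ l∈) (Dominates-trans 𝒜 l↝j j↝i)
    where
    l↝j : Dominates 𝒜 l j
    l↝j = ∉Aset⇒Dominates 𝒜 j∉Al
  climb U≡⊤ j (acc larger) j-low j↝i | no none =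
    j , j-low , count-Scoll-undominated 𝒜 U≡⊤ j-low undominated , j↝i
    where
    undominated : ∀ {l} → l LM.∈ lowIdx m → l ≢ j → ¬ Dominates 𝒜 l j
    undominated l∈ l≢j l↝j = none (LM.lose l∈ (l≢j , Dominates⇒∉Aset 𝒜 l↝j))

lemma1 : (m : ℕ) (𝒜 : List (Subset m)) → Unique 𝒜 → UnionClosed 𝒜 → Separating 𝒜 → Universe 𝒜 ≡ ⊤
    → ((a b : Fin m) → toℕ a ≤ toℕ b → count a 𝒜 ≤ count b 𝒜)
    → (i : Fin m) → suc (toℕ i) < m → count i (Scoll 𝒜) < m ∸ 1
    → Σ (Fin m) λ k → suc (toℕ k) < m × count k (Scoll 𝒜) ≡ m ∸ 1 × Dominates 𝒜 k i
lemma1 m 𝒜 _ _ separating U≡⊤ ordered i i-low _ =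
  climb separating ordered U≡⊤ i (>-wellFounded i) i-low (Dominates-refl 𝒜)
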